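{- Let $\mathcal{M}$ be an $(n-1)$-maniplex, let $i\in\{0,\dots,n-1\}$, let $F$ be an $i$-face of $\mathcal{M}$ and let $\mathcal{M}_F$ be the corresponding $(i-1)$-maniplex. Let $\mathcal{C}$ be the connected component of $T^i(\mathcal{M})$ corresponding to $F$ (that is, the component containing the $\mathrm{Aut}(\mathcal{M})$-orbits of the flags of $F$). Then there is a surjective function $\pi:V(\mathcal{C})\to V(T(\mathcal{M}_F))$ such that, for every vertex $u$ of $\mathcal{C}$ and every colour $j\neq i$, writing $u^j$ for the vertex joined to $u$ by the edge or semi-edge of colour $j$: if $j<i$ then $T(\mathcal{M}_F)$ has an edge (or semi-edge) of colour $j$ between $\pi(u)$ and $\pi(u^j)$, and if $j>i$ then $\pi(u)=\pi(u^j)$.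
   Context: An $m$-maniplex is given by a connected simple graph (flag graph), whose vertices are called flags, with a proper edge-colouring by colours $\{0,\dots,m\}$ in which each colour class is a perfect matching, such that for colours $i,j$ with $|i-j|\ge2$ each component of the subgraph spanned by colours $i,j$ is a 4-cycle. Automorphisms are colour-preserving graph automorphisms, forming $\mathrm{Aut}(\mathcal{M})$. For an $(n-1)$-maniplex $\mathcal{M}$ (colours $0,\dots,n-1$), an $i$-face is a connected component of the flag graph with the $i$-coloured edges deleted. For an $i$-face $F$, $\mathcal{M}_F$ is the $(i-1)$-maniplex obtained by deleting from $F$ the edges of colours $i+1,\dots,n-1$ and taking one connected component (all such components are isomorphic). The symmetry type graph $T(\mathcal{X})$ of a maniplex $\mathcal{X}$ is the pregraph whose vertices are the $\mathrm{Aut}(\mathcal{X})$-orbits of flags, with an edge of colour $a$ between distinct orbits $B,C$ iff some flag of $B$ is $a$-adjacent to a flag of $C$, and a semi-edge of colour $a$ at $B$ iff some flag of $B$ is $a$-adjacent to a flag of $B$; each vertex carries exactly one edge or semi-edge of each colour. $T^i(\mathcal{M})$ denotes $T(\mathcal{M})$ with all edges and semi-edges of colour $i$ deleted; its connected components correspond to the $\mathrm{Aut}(\mathcal{M})$-orbits of $i$-faces. -}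

module Defs where

open import Data.Nat using (ℕ; _≤_; _<_; _+_)
open import Data.Fin using (Fin; toℕ)
open import Data.Unit using (⊤)
open import Data.Product using (Σ; _×_)
open import Relation.Binary.PropositionalEquality using (_≡_; _≢_)

data Walk {k : ℕ} {A : Set} (r : Fin k → A → A) (Allowed : Fin k → Set) (x : A) : A → Set where
  here : Walk r Allowed x x
  step : ∀ {y} → Walk r Allowed x y → (j : Fin k) → Allowed j → Walk r Allowed x (r j y)

-- A maniplex with colour set {0,…,k-1} (i.e. a (k-1)-maniplex), given by its flag graph:
-- r j x is the unique flag j-adjacent to x (colour classes are perfect matchings).
record Maniplex (k : ℕ) : Set₁ where
  field
    Flag      : Set
    r         : Fin k → Flag → Flag
    r-invol   : ∀ j x → r j (r j x) ≡ x
    r-noloop  : ∀ j x → r j x ≢ x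
    r-simple  : ∀ j l x → j ≢ l → r j x ≢ r l x
    r-comm    : ∀ j l x → 2 + toℕ j ≤ toℕ l → r j (r l x) ≡ r l (r j x)
    connected : ∀ x y → Walk r (λ _ → ⊤) x y

module _ {n : ℕ} (M : Maniplex n) where
  open Maniplex M

  record Aut : Set where
    field
      to      : Flag → Flag
      from    : Flag → Flag
      from-to : ∀ x → from (to x) ≡ x
      to-from : ∀ x → to (from x) ≡ x
      comm    : ∀ j x → to (r j x) ≡ r j (to x)

  SameOrbit : Flag → Flag → Set
  SameOrbit x y = Σ Aut (λ φ → Aut.to φ x ≡ y)

  module _ (i : Fin n) (x₀ : Flag) where

    -- flags of the i-face F containing x₀
    InFace : Flag → Set
    InFace = Walk r (λ j → j ≢ i) x₀

    -- flags of M_F : the component of x₀ in F after deleting colours > i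
    -- (an (i-1)-maniplex with colours 0,…,i-1)
    InMF : Flag → Set
    InMF = Walk r (λ j → toℕ j < toℕ i) x₀

    record AutF : Set where
      field
        to      : Flag → Flag
        from    : Flag → Flag
        to-in   : ∀ x → InMF x → InMF (to x)
        from-in : ∀ x → InMF x → InMF (from x)
        from-to : ∀ x → InMF x → from (to x) ≡ x
        to-from : ∀ x → InMF x → to (from x) ≡ x
        comm    : ∀ (j : Fin n) → toℕ j < toℕ i → ∀ x → InMF x → to (r j x) ≡ r j (to x)

    -- same Aut(M_F)-orbit (vertices of T(M_F) are these orbits)
    SameOrbitF : Flag → Flag → Set
    SameOrbitF x y = Σ AutF (λ φ → AutF.to φ x ≡ y)

    -- T(M_F) has an edge or semi-edge of colour j between the orbits of p and q
    EdgeTF : Fin n → Flag → Flag → Set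
    EdgeTF j p q = Σ Flag (λ p' → SameOrbitF p p' × SameOrbitF (r j p') q)

    -- flags whose Aut(M)-orbit lies in the component C of T^i(M) containing
    -- the orbits of the flags of F
    data InC : Flag → Set where
      base : ∀ y z → InFace y → SameOrbit y z → InC z
      step : ∀ y b z (j : Fin n) → InC y → j ≢ i →
             SameOrbit y b → SameOrbit (r j b) z → InC z

module Submission where

-- Every flag z whose orbit lies in C can be written as z = σ a with a a flag of M_F and
-- σ a bijection of all flags commuting with the colours below i: σ is a product of
-- automorphisms of M and of reflections r j with j > i, and the latter commute with every
-- colour below i since the colours differ by at least 2. Such a σ restricts to an
-- automorphism of M_F as soon as it maps one flag of M_F into M_F, so the Aut(M_F)-orbit
-- of a depends only on the Aut(M)-orbit of z; this is π. A colour j < i moves a along an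
-- edge of M_F, while a colour j > i only changes σ.

open import Defs
open import Data.Nat using (ℕ; _<_; _≤_; _+_; s≤s)
open import Data.Nat.Properties using (<-cmp; <-irrefl; ≤-trans)
open import Data.Fin using (Fin; toℕ)
open import Data.Fin.Properties using (toℕ-injective)
open import Data.Product using (Σ; _×_; _,_)
open import Data.Empty using (⊥-elim)
open import Relation.Binary using (tri<; tri≈; tri>)
open import Relation.Binary.PropositionalEquality

module _ {k : ℕ} {A : Set} {r : Fin k → A → A} where

  walk-++ : ∀ {P x y z} → Walk r P x y → Walk r P y z → Walk r P x z
  walk-++ W here         = W
  walk-++ W (step V j p) = step (walk-++ W V) j p

  walk-weaken : ∀ {P Q} → (∀ j → P j → Q j) → ∀ {x y} → Walk r P x y → Walk r Q x y
  walk-weaken P⇒Q here         = here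
  walk-weaken P⇒Q (step W j p) = step (walk-weaken P⇒Q W) j (P⇒Q j p)

  walk-reverse : (∀ j x → r j (r j x) ≡ x) → ∀ {P x y} → Walk r P x y → Walk r P y x
  walk-reverse invol here = here
  walk-reverse invol {P} (step {y} W j p) =
    walk-++ (subst (Walk r P (r j y)) (invol j y) (step here j p)) (walk-reverse invol W)

Below : ∀ {n} → Fin n → Fin n → Set
Below i j = toℕ j < toℕ i

module _ {n : ℕ} (M : Maniplex n) where
  open Maniplex M

  Aut-id : Aut M
  Aut-id = record
    { to = λ x → x ; from = λ x → x
    ; from-to = λ _ → refl ; to-from = λ _ → refl ; comm = λ _ _ → refl }

  record ColourAut (P : Fin n → Set) : Set where
    field
      to      : Flag → Flag
      from    : Flag → Flag
      from-to : ∀ x → from (to x) ≡ x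
      to-from : ∀ x → to (from x) ≡ x
      comm    : ∀ j → P j → ∀ x → to (r j x) ≡ r j (to x)

  module _ {P : Fin n → Set} where
    open ColourAut

    idᶜ : ColourAut P
    idᶜ = record
      { to = λ x → x ; from = λ x → x
      ; from-to = λ _ → refl ; to-from = λ _ → refl ; comm = λ _ _ _ → refl }

    _∘ᶜ_ : ColourAut P → ColourAut P → ColourAut P
    σ ∘ᶜ τ = record
      { to      = λ x → to σ (to τ x)
      ; from    = λ x → from τ (from σ x)
      ; from-to = λ x → trans (cong (from τ) (from-to σ (to τ x))) (from-to τ x)
      ; to-from = λ x → trans (cong (to σ) (to-from τ (from σ x))) (to-from σ x)
      ; comm    = λ j p x → trans (cong (to σ) (comm τ j p x)) (comm σ j p (to τ x))
      }

    from-comm : (σ : ColourAut P) → ∀ j → P j → ∀ x → from σ (r j x) ≡ r j (from σ x)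
    from-comm σ j p x = begin
      from σ (r j x)                     ≡⟨ cong (λ y → from σ (r j y)) (sym (to-from σ x)) ⟩
      from σ (r j (to σ (from σ x)))     ≡⟨ cong (from σ) (sym (comm σ j p (from σ x))) ⟩
      from σ (to σ (r j (from σ x)))     ≡⟨ from-to σ (r j (from σ x)) ⟩
      r j (from σ x)                     ∎
      where open ≡-Reasoning

    _⁻¹ᶜ : ColourAut P → ColourAut P
    σ ⁻¹ᶜ = record
      { to = from σ ; from = to σ
      ; from-to = to-from σ ; to-from = from-to σ ; comm = from-comm σ }

    fromAut : Aut M → ColourAut P
    fromAut φ = record
      { to = Aut.to φ ; from = Aut.from φ
      ; from-to = Aut.from-to φ ; to-from = Aut.to-from φ ; comm = λ j _ → Aut.comm φ j }

    reflection : (j : Fin n) → (∀ l → P l → 2 + toℕ l ≤ toℕ j) → ColourAut P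
    reflection j far = record
      { to = r j ; from = r j
      ; from-to = r-invol j ; to-from = r-invol j
      ; comm = λ l p x → sym (r-comm l j x (far l p)) }

    walk-image : (σ : ColourAut P) → ∀ {x y} → Walk r P x y → Walk r P (to σ x) (to σ y)
    walk-image σ here = here
    walk-image σ {x} (step {y} W j p) =
      subst (Walk r P (to σ x)) (sym (comm σ j p y)) (step (walk-image σ W) j p)

  module _ (i : Fin n) (x₀ : Flag) where
    open ColourAut

    image-InMF : (σ : ColourAut (Below i)) → ∀ {a x} →
      InMF M i x₀ a → InMF M i x₀ (to σ a) → InMF M i x₀ x → InMF M i x₀ (to σ x)
    image-InMF σ a∈ σa∈ x∈ =
      walk-++ (walk-++ σa∈ (walk-image σ (walk-reverse r-invol a∈))) (walk-image σ x∈)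

    restrict-sameOrbitF : (σ : ColourAut (Below i)) → ∀ {a b} →
      InMF M i x₀ a → InMF M i x₀ b → to σ a ≡ b → SameOrbitF M i x₀ a b
    restrict-sameOrbitF σ {a} {b} a∈ b∈ σa≡b =
      record
        { to      = to σ
        ; from    = from σ
        ; to-in   = λ _ → image-InMF σ a∈ (subst (InMF M i x₀) (sym σa≡b) b∈)
        ; from-in = λ _ → image-InMF (σ ⁻¹ᶜ) b∈ (subst (InMF M i x₀) (sym σ⁻¹b≡a) a∈)
        ; from-to = λ x _ → from-to σ x
        ; to-from = λ x _ → to-from σ x
        ; comm    = λ j p x _ → comm σ j p x
        } , σa≡b
      where
      σ⁻¹b≡a : from σ b ≡ a
      σ⁻¹b≡a = trans (cong (from σ) (sym σa≡b)) (from-to σ a)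

    sameOrbitF-of-common-image : (σ τ : ColourAut (Below i)) → ∀ {a b} →
      InMF M i x₀ a → InMF M i x₀ b → to σ a ≡ to τ b → SameOrbitF M i x₀ a b
    sameOrbitF-of-common-image σ τ {b = b} a∈ b∈ σa≡τb =
      restrict-sameOrbitF ((τ ⁻¹ᶜ) ∘ᶜ σ) a∈ b∈
        (trans (cong (from τ) σa≡τb) (from-to τ b))

    record Decomposition (z : Flag) : Set where
      field
        flag     : Flag
        flag∈MF  : InMF M i x₀ flag
        σ        : ColourAut (Below i)
        σ-flag   : to σ flag ≡ z

    open Decomposition

    trivial-decomposition : ∀ {a} → InMF M i x₀ a → Decomposition a
    trivial-decomposition {a} a∈ = record { flag = a ; flag∈MF = a∈ ; σ = idᶜ ; σ-flag = refl }

    decompositions-sameOrbitF : ∀ {z} (d d' : Decomposition z) →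
      SameOrbitF M i x₀ (flag d) (flag d')
    decompositions-sameOrbitF d d' = sameOrbitF-of-common-image (σ d) (σ d')
      (flag∈MF d) (flag∈MF d') (trans (σ-flag d) (sym (σ-flag d')))

    decomposition-below : ∀ {z} → Decomposition z → (j : Fin n) → Below i j →
      Decomposition (r j z)
    decomposition-below d j j<i = record
      { flag = r j (flag d) ; flag∈MF = step (flag∈MF d) j j<i ; σ = σ d
      ; σ-flag = trans (comm (σ d) j j<i (flag d)) (cong (r j) (σ-flag d)) }

    decomposition-above : ∀ {z} → Decomposition z → (j : Fin n) → toℕ i < toℕ j →
      Decomposition (r j z)
    decomposition-above d j i<j = record
      { flag = flag d ; flag∈MF = flag∈MF d
      ; σ = reflection j (λ l l<i → ≤-trans (s≤s l<i) i<j) ∘ᶜ σ d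
      ; σ-flag = cong (r j) (σ-flag d) }

    decomposition-r : ∀ {z} → Decomposition z → (j : Fin n) → j ≢ i → Decomposition (r j z)
    decomposition-r d j j≢i with <-cmp (toℕ j) (toℕ i)
    ... | tri< j<i _ _ = decomposition-below d j j<i
    ... | tri≈ _ j≡i _ = ⊥-elim (j≢i (toℕ-injective j≡i))
    ... | tri> _ _ i<j = decomposition-above d j i<j

    decomposition-orbit : ∀ {y z} → SameOrbit M y z → Decomposition y → Decomposition z
    decomposition-orbit (φ , φy≡z) d = record
      { flag = flag d ; flag∈MF = flag∈MF d ; σ = fromAut φ ∘ᶜ σ d
      ; σ-flag = trans (cong (Aut.to φ) (σ-flag d)) φy≡z }

    decomposition-face : ∀ {w} → InFace M i x₀ w → Decomposition w
    decomposition-face here           = trivial-decomposition here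
    decomposition-face (step W j j≢i) = decomposition-r (decomposition-face W) j j≢i

    decompose : ∀ {z} → InC M i x₀ z → Decomposition z
    decompose (base y z y∈F y~z)            = decomposition-orbit y~z (decomposition-face y∈F)
    decompose (step y b z j c j≢i y~b rb~z) =
      decomposition-orbit rb~z (decomposition-r (decomposition-orbit y~b (decompose c)) j j≢i)

open Decomposition

proposition3p2 : ∀ {n : ℕ} (M : Maniplex n) (i : Fin n) (x₀ : Maniplex.Flag M) →
    Σ ((y : Maniplex.Flag M) → InC M i x₀ y → Maniplex.Flag M) λ π →
      ((y : Maniplex.Flag M) (c : InC M i x₀ y) → InMF M i x₀ (π y c))
      × ((y y' : Maniplex.Flag M) (c : InC M i x₀ y) (c' : InC M i x₀ y') →
           SameOrbit M y y' → SameOrbitF M i x₀ (π y c) (π y' c'))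
      × ((p : Maniplex.Flag M) → InMF M i x₀ p →
           Σ (Maniplex.Flag M) λ y → Σ (InC M i x₀ y) λ c → SameOrbitF M i x₀ (π y c) p)
      × ((y : Maniplex.Flag M) (c : InC M i x₀ y) (j : Fin n)
           (c' : InC M i x₀ (Maniplex.r M j y)) →
           (toℕ j < toℕ i → EdgeTF M i x₀ j (π y c) (π (Maniplex.r M j y) c'))
           × (toℕ i < toℕ j → SameOrbitF M i x₀ (π y c) (π (Maniplex.r M j y) c')))
proposition3p2 M i x₀ =
  π , (λ _ c → flag∈MF (dec c)) , orbits , surjective ,
  λ y c j c' → below y c j c' , above y c j c'
  where
  open Maniplex M
  dec : ∀ {z} → InC M i x₀ z → Decomposition M i x₀ z
  dec = decompose M i x₀

  well-defined : ∀ {z} (d d' : Decomposition M i x₀ z) → SameOrbitF M i x₀ (flag d) (flag d')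
  well-defined = decompositions-sameOrbitF M i x₀

  π : (y : Flag) → InC M i x₀ y → Flag
  π _ c = flag (dec c)

  orbits : ∀ y y' c c' → SameOrbit M y y' → SameOrbitF M i x₀ (π y c) (π y' c')
  orbits y y' c c' y~y' = well-defined (decomposition-orbit M i x₀ y~y' (dec c)) (dec c')

  surjective : ∀ p → InMF M i x₀ p →
    Σ Flag λ y → Σ (InC M i x₀ y) λ c → SameOrbitF M i x₀ (π y c) p
  surjective p p∈ = p , c , well-defined (dec c) (trivial-decomposition M i x₀ p∈)
    where
    c : InC M i x₀ p
    c = base p p (walk-weaken (λ j j<i j≡i → <-irrefl (cong toℕ j≡i) j<i) p∈) (Aut-id M , refl)

  below : ∀ y c j c' → toℕ j < toℕ i → EdgeTF M i x₀ j (π y c) (π (r j y) c')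
  below y c j c' j<i =
    π y c , well-defined (dec c) (dec c) ,
    well-defined (decomposition-below M i x₀ (dec c) j j<i) (dec c')

  above : ∀ y c j c' → toℕ i < toℕ j → SameOrbitF M i x₀ (π y c) (π (r j y) c')
  above y c j c' i<j = well-defined (decomposition-above M i x₀ (dec c) j i<j) (dec c')
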